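{- For every graph $G$ on $n$ vertices, $\chi_{rs}(G)\leq n-\alpha(G)+1$.
   Context: All graphs are finite, simple and undirected. $\alpha(G)$ is the independence number of $G$. For $k\in\mathbb{N}$, a $k$-restricted star colouring of $G$ is a map $f:V(G)\to\{0,\dots,k-1\}$ with $f(x)\neq f(y)$ for every edge $xy$ and with no path $x,y,z$ in $G$ (not necessarily induced) such that $f(y)>f(x)=f(z)$. $\chi_{rs}(G)$ is the least $k$ such that $G$ admits a $k$-restricted star colouring. -}

module Defs where

open import Data.Nat using (ℕ; _≤_; _<_)
open import Data.Fin using (Fin)
open import Data.Fin.Subset using (Subset; _∈_; ∣_∣)
open import Data.Product using (Σ; _×_; ∃)
open import Relation.Nullary using (¬_)
open import Relation.Binary.PropositionalEquality using (_≡_)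
open import Level using (0ℓ)
open import Agda.Primitive using (lsuc)

record Graph (n : ℕ) : Set₁ where
  field
    Adj     : Fin n → Fin n → Set
    irrefl  : ∀ x → ¬ Adj x x
    sym     : ∀ {x y} → Adj x y → Adj y x
open Graph public

IsIndependent : ∀ {n} → Graph n → Subset n → Set
IsIndependent G S = ∀ x y → x ∈ S → y ∈ S → ¬ Adj G x y

IsIndependenceNumber : ∀ {n} → Graph n → ℕ → Set
IsIndependenceNumber {n} G a =
  (Σ (Subset n) λ S → IsIndependent G S × ∣ S ∣ ≡ a)
  × (∀ S → IsIndependent G S → ∣ S ∣ ≤ a)

IsRestrictedStarColouring : ∀ {n} → Graph n → (k : ℕ) → (Fin n → Fin k) → Set
IsRestrictedStarColouring {n} G k f =
  (∀ x y → Adj G x y → ¬ f x ≡ f y)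
  × (∀ x y z → ¬ x ≡ z → Adj G x y → Adj G y z → f x ≡ f z → ¬ (f x Data.Fin.< f y))
  where import Data.Fin

-- χ_rs(G) ≤ k  ⇔  G admits a k-restricted star colouring
-- (restricted star colourings are monotone in k, so this is the
-- meaning of the upper bound on the least such k).
HasRestrictedStarColouring : ∀ {n} → Graph n → ℕ → Set
HasRestrictedStarColouring {n} G k =
  ∃ λ (f : Fin n → Fin k) → IsRestrictedStarColouring G k f

{-# OPTIONS --safe #-}
-- Let S be a maximum independent set. Give every vertex of S the top colour
-- n − α(G) and the remaining n − α(G) vertices pairwise distinct colours below
-- it. Two distinct vertices of the same colour then both lie in S: they are
-- non-adjacent, so the colouring is proper, and their common colour is maximal,
-- so no path x, y, z with f(x) = f(z) has f(y) > f(x).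
module Submission where

open import Defs hiding (sym)
open import Data.Nat using (ℕ; suc; _∸_; _+_)
open import Data.Nat.Properties using (+-suc; +-comm; m+n∸n≡m; ≤⇒≯)
open import Data.Bool using (true; false)
open import Data.Vec using (_∷_; [])
open import Data.Vec.Base using (here; there)
open import Data.Fin using (Fin; fromℕ; _<_) renaming (zero to fzero; suc to fsuc)
open import Data.Fin.Properties using (suc-injective; ≤fromℕ)
open import Data.Fin.Subset using (Subset; _∈_; _∉_; ∣_∣)
open import Data.Fin.Subset.Properties using (_∈?_; drop-not-there)
open import Data.Product using (Σ; _×_; _,_)
open import Relation.Nullary using (¬_; yes; no; contradiction)
open import Relation.Binary.PropositionalEquality
  using (_≡_; _≢_; ≢-sym; refl; cong; sym; trans; subst; module ≡-Reasoning)

record IsTopCollapse {n k : ℕ} (S : Subset n) (g : Fin n → Fin (suc k)) : Set where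
  field
    top-on-S        : ∀ {x} → x ∈ S → g x ≡ fromℕ k
    below-off-S     : ∀ {x} → x ∉ S → g x ≢ fromℕ k
    injective-off-S : ∀ {x y} → x ∉ S → y ∉ S → g x ≡ g y → x ≡ y

  collision⇒∈ : ∀ {x z} → x ≢ z → g x ≡ g z → x ∈ S
  collision⇒∈ {x} {z} x≢z gx≡gz with x ∈? S | z ∈? S
  ... | yes x∈S | _       = x∈S
  ... | no x∉S  | yes z∈S = contradiction (subst (g x ≡_) (top-on-S z∈S) gx≡gz) (below-off-S x∉S)
  ... | no x∉S  | no z∉S  = contradiction (injective-off-S x∉S z∉S gx≡gz) x≢z

open IsTopCollapse

TopCollapse : ∀ {n} → Subset n → Set
TopCollapse {n} S =
  Σ ℕ λ k → k + ∣ S ∣ ≡ n × Σ (Fin n → Fin (suc k)) λ g → IsTopCollapse S g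

module _ {n k : ℕ} {S : Subset n} {g : Fin n → Fin (suc k)} (c : IsTopCollapse S g) where

  private
    g-inside : Fin (suc n) → Fin (suc k)
    g-inside fzero    = fromℕ k
    g-inside (fsuc x) = g x

  extend-inside : IsTopCollapse (true ∷ S) g-inside
  extend-inside .top-on-S here                = refl
  extend-inside .top-on-S (there x∈S)         = top-on-S c x∈S
  extend-inside .below-off-S {fzero}  x∉      = contradiction here x∉
  extend-inside .below-off-S {fsuc _} x∉      = below-off-S c (drop-not-there x∉)
  extend-inside .injective-off-S {fzero} x∉ _ _ = contradiction here x∉
  extend-inside .injective-off-S {fsuc _} {fzero} _ y∉ _ = contradiction here y∉
  extend-inside .injective-off-S {fsuc _} {fsuc _} x∉ y∉ eq =
    cong fsuc (injective-off-S c (drop-not-there x∉) (drop-not-there y∉) eq)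

  private
    g-outside : Fin (suc n) → Fin (suc (suc k))
    g-outside fzero    = fzero
    g-outside (fsuc x) = fsuc (g x)

  extend-outside : IsTopCollapse (false ∷ S) g-outside
  extend-outside .top-on-S (there x∈S)       = cong fsuc (top-on-S c x∈S)
  extend-outside .below-off-S {fzero}  _  ()
  extend-outside .below-off-S {fsuc _} x∉ eq = below-off-S c (drop-not-there x∉) (suc-injective eq)
  extend-outside .injective-off-S {fzero} {fzero} _ _ _ = refl
  extend-outside .injective-off-S {fsuc _} {fsuc _} x∉ y∉ eq =
    cong fsuc (injective-off-S c (drop-not-there x∉) (drop-not-there y∉) (suc-injective eq))

topCollapse : ∀ {n} (S : Subset n) → TopCollapse S
topCollapse [] = 0 , refl , (λ ()) , record
  { top-on-S = λ () ; below-off-S = λ { {()} } ; injective-off-S = λ { {()} } }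
topCollapse (true ∷ S) with topCollapse S
... | k , k+∣S∣≡n , _ , c = k , trans (+-suc k ∣ S ∣) (cong suc k+∣S∣≡n) , _ , extend-inside c
topCollapse (false ∷ S) with topCollapse S
... | k , k+∣S∣≡n , _ , c = suc k , cong suc k+∣S∣≡n , _ , extend-outside c

topCollapse⇒restrictedStarColouring :
  ∀ {n k} {G : Graph n} {S : Subset n} {g : Fin n → Fin (suc k)} →
  IsIndependent G S → IsTopCollapse S g → IsRestrictedStarColouring G (suc k) g
topCollapse⇒restrictedStarColouring {G = G} {g = g} independent c = proper , star-free
  where
  adjacent⇒distinct : ∀ {x y} → Adj G x y → x ≢ y
  adjacent⇒distinct {x} xy refl = irrefl G x xy

  proper : ∀ x y → Adj G x y → g x ≢ g y
  proper x y xy gx≡gy =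
    independent x y (collision⇒∈ c x≢y gx≡gy) (collision⇒∈ c (≢-sym x≢y) (sym gx≡gy)) xy
    where x≢y = adjacent⇒distinct xy

  star-free : ∀ x y z → x ≢ z → Adj G x y → Adj G y z → g x ≡ g z → ¬ (g x < g y)
  star-free x y z x≢z _ _ gx≡gz
    rewrite top-on-S c (collision⇒∈ c x≢z gx≡gz) = ≤⇒≯ (≤fromℕ (g y))

independent⇒restrictedStarColouring :
  ∀ {n} {G : Graph n} {S : Subset n} →
  IsIndependent G S → HasRestrictedStarColouring G ((n ∸ ∣ S ∣) + 1)
independent⇒restrictedStarColouring {n} {G} {S} independent with topCollapse S
... | k , k+∣S∣≡n , g , c =
  subst (HasRestrictedStarColouring G) colours
    (g , topCollapse⇒restrictedStarColouring {G = G} independent c)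
  where
  open ≡-Reasoning
  colours : suc k ≡ (n ∸ ∣ S ∣) + 1
  colours = begin
    suc k                   ≡⟨ +-comm 1 k ⟩
    k + 1                   ≡⟨ cong (_+ 1) (sym (m+n∸n≡m k ∣ S ∣)) ⟩
    (k + ∣ S ∣ ∸ ∣ S ∣) + 1 ≡⟨ cong (λ m → (m ∸ ∣ S ∣) + 1) k+∣S∣≡n ⟩
    (n ∸ ∣ S ∣) + 1         ∎

mainTheorem19 : (n : ℕ) (G : Graph n) (a : ℕ) → IsIndependenceNumber G a →
                  HasRestrictedStarColouring G ((n ∸ a) + 1)
mainTheorem19 n G a ((S , independent , ∣S∣≡a) , _) =
  subst (λ m → HasRestrictedStarColouring G ((n ∸ m) + 1)) ∣S∣≡a
    (independent⇒restrictedStarColouring {G = G} independent)
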